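{- Fix $k\ge2$ and let $\pi$ be a permutation containing a decreasing subsequence of length $k$, with A-sequence $a_k\cdots a_1$ and B-sequence $b_k\cdots b_1$. Assume $a_d=b_e$ with $e>1$ and that $b_{e-1}$ does not belong to the A-sequence. Then $d>1$, $b_{e-1}$ precedes $a_{d-1}$, $b_{e-1}<a_{d-1}$, and $\ell(b_{e-1})<\ell(a_{d-1})=d-1$. Symmetrically, if $a_i=b_j$ with $i<k$ and $a_{i+1}$ does not belong to the B-sequence, then $j<k$, $a_{i+1}$ precedes $b_{j+1}$, and $a_{i+1}<b_{j+1}$.
   Context: Letters of $\pi$ are identified with their values; "$x$ precedes $y$" means $x$ is at a smaller position. The A-sequence is the lexicographically smallest (as a sequence of values read left to right) decreasing subsequence of length $k$. The B-sequence $b_k\cdots b_1$ is defined recursively: $b_1$ is the leftmost letter that is the last letter of a decreasing subsequence of length $k$, and for $j\ge2$, $b_j$ is the leftmost letter such that $b_j\cdots b_1$ is a suffix of a decreasing subsequence of length $k$. The label $\ell(x)$ of a letter $x$ is the maximal length of a decreasing subsequence of $\pi$ starting at $x$. -}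

module Defs where

open import Data.Nat using (ℕ; zero; suc; _≤_; _<_)
open import Data.Fin using (Fin)
import Data.Fin as F
open import Data.Fin.Permutation using (Permutation′; _⟨$⟩ʳ_)
open import Data.Product using (Σ; ∃; _×_; _,_)
open import Data.Sum using (_⊎_)
open import Relation.Binary.PropositionalEquality using (_≡_)

-- A permutation π of [n] is a bijection from positions (Fin n) to values (Fin n).
-- Letters are handled through their positions p : Fin n; the value of the letter
-- at position p is  π ⟨$⟩ʳ p.  Since π is a bijection, letters and positions
-- determine each other.

Precedes : ∀ {n} → Fin n → Fin n → Set
Precedes p q = p F.< q

ValLt : ∀ {n} → Permutation′ n → Fin n → Fin n → Set
ValLt π p q = (π ⟨$⟩ʳ p) F.< (π ⟨$⟩ʳ q)

-- A decreasing subsequence  s_k ⋯ s_1  of length k, written with the paper's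
-- subscripts: s_k is leftmost, s_1 is rightmost.  s is a function of the
-- subscript; only subscripts 1..k are meaningful.
IsDecSeq : ∀ {n} → Permutation′ n → ℕ → (ℕ → Fin n) → Set
IsDecSeq π k s = ∀ i j → 1 ≤ i → i < j → j ≤ k →
  Precedes (s j) (s i) × ValLt π (s i) (s j)

SameSeq : ∀ {n} → ℕ → (ℕ → Fin n) → (ℕ → Fin n) → Set
SameSeq k s t = ∀ i → 1 ≤ i → i ≤ k → s i ≡ t i

LexLeq : ∀ {n} → Permutation′ n → ℕ → (ℕ → Fin n) → (ℕ → Fin n) → Set
LexLeq π k s t = SameSeq k s t ⊎
  (Σ ℕ λ m → 1 ≤ m × m ≤ k ×
     (∀ i → m < i → i ≤ k → s i ≡ t i) × ValLt π (s m) (t m))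

IsASeq : ∀ {n} → Permutation′ n → ℕ → (ℕ → Fin n) → Set
IsASeq π k A = IsDecSeq π k A × (∀ S → IsDecSeq π k S → LexLeq π k A S)

-- The B-sequence b_k ⋯ b_1: for each j ∈ 1..k, b_j ⋯ b_1 is a suffix of a
-- decreasing subsequence of length k, and b_j is the leftmost letter x such that
-- x b_{j-1} ⋯ b_1 is such a suffix.
IsBSeq : ∀ {n} → Permutation′ n → ℕ → (ℕ → Fin n) → Set
IsBSeq {n} π k B = ∀ j → 1 ≤ j → j ≤ k →
  (Σ (ℕ → Fin n) λ S → IsDecSeq π k S × (∀ i → 1 ≤ i → i ≤ j → S i ≡ B i))
  × (∀ (S : ℕ → Fin n) → IsDecSeq π k S → (∀ i → 1 ≤ i → i < j → S i ≡ B i) →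
       B j F.≤ S j)

InSeq : ∀ {n} → ℕ → (ℕ → Fin n) → Fin n → Set
InSeq k s x = Σ ℕ λ i → 1 ≤ i × i ≤ k × s i ≡ x

IsLabel : ∀ {n} → Permutation′ n → Fin n → ℕ → Set
IsLabel {n} π x m = (Σ (ℕ → Fin n) λ s → 1 ≤ m × IsDecSeq π m s × s m ≡ x)
  × (∀ m′ (s : ℕ → Fin n) → 1 ≤ m′ → IsDecSeq π m′ s → s m′ ≡ x → m′ ≤ m)

-- Write x ↘ y when x precedes y and x > y.  The A-sequence is lexicographically least
-- and every b_j is leftmost given b_{j-1} ⋯ b_1, so no decreasing subsequence of length k
-- agrees with A above an index D and is smaller at D, and none agrees with B below an
-- index J and has its J-th letter left of b_J.  Every contradiction in the proof is such a
-- forbidden competitor, spliced together from shifted runs of A and B.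
--
-- A common letter has B-index at most its A-index, so write the meeting point as
-- a_{m+g} = b_m.  Below it, b_t ↘ a_{t+g} is impossible, and then so is a_{t+g} preceding
-- b_t, by induction upwards from t = 1.  Above it, b_l ↘ a_{l+g} is impossible, and then
-- so is b_l < a_{l+g}, by induction downwards from the top.  As b_{e-1} ∉ A (resp.
-- a_{i+1} ∉ B), the two letters compared are distinct, and only the claimed relative
-- position remains.  For the labels, ℓ(a_i) = i, and a letter x with a_{i+1} ↘ x and
-- x < a_i has ℓ(x) < i.

module Submission where

open import Defs
open import Data.Nat using (ℕ; zero; suc; _≤_; _<_; _∸_; _+_; z≤n; s≤s; _≤?_)
open import Data.Nat.Properties
open import Data.Fin using (Fin)
import Data.Fin.Properties as Finₚ
open import Data.Fin.Permutation using (Permutation′)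
open import Data.Product using (Σ; _×_; _,_; proj₁; proj₂)
open import Data.Sum using (_⊎_; inj₁; inj₂)
open import Function using (Injection; _∘_)
open import Function.Properties.Inverse using (↔⇒↣)
open import Relation.Nullary using (¬_; yes; no; contradiction)
open import Relation.Binary using (tri<; tri≈; tri>)
open import Relation.Binary.PropositionalEquality

≢⇒<⊎> : ∀ {n} {i j : Fin n} → i ≢ j → Precedes i j ⊎ Precedes j i
≢⇒<⊎> {i = i} {j} i≢j with Finₚ.<-cmp i j
... | tri< i<j _ _ = inj₁ i<j
... | tri≈ _ i≡j _ = contradiction i≡j i≢j
... | tri> _ _ j<i = inj₂ j<i

¬InSeq⇒≢ : ∀ {n k i} {s : ℕ → Fin n} {x} → 1 ≤ i → i ≤ k → ¬ InSeq k s x → x ≢ s i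
¬InSeq⇒≢ {i = i} 1≤i i≤k x∉s x≡sᵢ = x∉s (i , 1≤i , i≤k , sym x≡sᵢ)

splice : ∀ {a} {X : Set a} → ℕ → (ℕ → X) → (ℕ → X) → ℕ → X
splice c s t l with l ≤? c
... | yes _ = s l
... | no  _ = t l

splice-≤ : ∀ {a} {X : Set a} {c l} (s t : ℕ → X) → l ≤ c → splice c s t l ≡ s l
splice-≤ {c = c} {l} s t l≤c with l ≤? c
... | yes _   = refl
... | no  l≰c = contradiction l≤c l≰c

splice-> : ∀ {a} {X : Set a} {c l} (s t : ℕ → X) → c < l → splice c s t l ≡ t l
splice-> {c = c} {l} s t c<l with l ≤? c
... | yes l≤c = contradiction l≤c (<⇒≱ c<l)
... | no  _   = refl

module _ {n} (π : Permutation′ n) where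

  infix 4 _↘_ _↗_

  _↘_ : Fin n → Fin n → Set
  p ↘ q = Precedes p q × ValLt π q p

  _↗_ : Fin n → Fin n → Set
  p ↗ q = Precedes p q × ValLt π p q

  ↘-trans : ∀ {p q r} → p ↘ q → q ↘ r → p ↘ r
  ↘-trans (p≺q , q<p) (q≺r , r<q) = Finₚ.<-trans p≺q q≺r , Finₚ.<-trans r<q q<p

  ValLt⇒≢ : ∀ {p q} → ValLt π p q → p ≢ q
  ValLt⇒≢ p<q refl = Finₚ.<-irrefl refl p<q

  ≢⇒ValLt⊎ValLt : ∀ {p q} → p ≢ q → ValLt π p q ⊎ ValLt π q p
  ≢⇒ValLt⊎ValLt p≢q = ≢⇒<⊎> (p≢q ∘ Injection.injective (↔⇒↣ π))

  Descending : ℕ → ℕ → (ℕ → Fin n) → Set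
  Descending lo hi s = ∀ l → lo ≤ l → suc l ≤ hi → s (suc l) ↘ s l

  Descending⇒↘ : ∀ {lo hi s i j} → Descending lo hi s → lo ≤ i → i < j → j ≤ hi → s j ↘ s i
  Descending⇒↘ {j = suc j} desc lo≤i i<1+j 1+j≤hi with m<1+n⇒m<n∨m≡n i<1+j
  ... | inj₂ refl = desc j lo≤i 1+j≤hi
  ... | inj₁ i<j  = ↘-trans (desc j (≤-trans lo≤i (<⇒≤ i<j)) 1+j≤hi)
                            (Descending⇒↘ desc lo≤i i<j (≤-trans (n≤1+n j) 1+j≤hi))

  Descending⇒IsDecSeq : ∀ {k s} → Descending 1 k s → IsDecSeq π k s
  Descending⇒IsDecSeq desc i j = Descending⇒↘ desc

  IsDecSeq⇒Descending : ∀ {k s} → IsDecSeq π k s → Descending 1 k s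
  IsDecSeq⇒Descending dec l 1≤l 1+l≤k = dec l (suc l) 1≤l ≤-refl 1+l≤k

  Descending-restrict : ∀ {lo hi lo′ hi′ s} → lo ≤ lo′ → hi′ ≤ hi →
                        Descending lo hi s → Descending lo′ hi′ s
  Descending-restrict lo≤lo′ hi′≤hi desc l lo′≤l 1+l≤hi′ =
    desc l (≤-trans lo≤lo′ lo′≤l) (≤-trans 1+l≤hi′ hi′≤hi)

  Descending-+ : ∀ {lo hi lo′ hi′ s} a → lo′ ≤ lo + a → hi + a ≤ hi′ →
                 Descending lo′ hi′ s → Descending lo hi (λ l → s (l + a))
  Descending-+ a lo′≤lo+a hi+a≤hi′ desc l lo≤l 1+l≤hi =
    desc (l + a) (≤-trans lo′≤lo+a (+-monoˡ-≤ a lo≤l)) (≤-trans (+-monoˡ-≤ a 1+l≤hi) hi+a≤hi′)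

  Descending-∸ : ∀ {lo hi lo′ hi′ s} a → lo′ + a ≤ lo → hi ≤ hi′ + a →
                 Descending lo′ hi′ s → Descending lo hi (λ l → s (l ∸ a))
  Descending-∸ {lo′ = lo′} {hi′} {s} a lo′+a≤lo hi≤hi′+a desc l lo≤l 1+l≤hi =
    subst (λ i → s i ↘ s (l ∸ a)) (sym 1+l∸a≡) (desc (l ∸ a) (m+n≤o⇒m≤o∸n lo′ lo′+a≤l) 1+l∸a≤hi′)
    where
    lo′+a≤l : lo′ + a ≤ l
    lo′+a≤l = ≤-trans lo′+a≤lo lo≤l
    1+l∸a≡ : suc l ∸ a ≡ suc (l ∸ a)
    1+l∸a≡ = +-∸-assoc 1 (m+n≤o⇒n≤o lo′ lo′+a≤l)
    1+l∸a≤hi′ : suc (l ∸ a) ≤ hi′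
    1+l∸a≤hi′ = subst (_≤ hi′) 1+l∸a≡
      (m≤n+o⇒m∸n≤o (suc l) a (subst (suc l ≤_) (+-comm hi′ a) (≤-trans 1+l≤hi hi≤hi′+a)))

  Descending-splice : ∀ {lo c hi s t} → Descending lo c s →
                      (lo ≤ c → suc c ≤ hi → t (suc c) ↘ s c) →
                      Descending (suc c) hi t → Descending lo hi (splice c s t)
  Descending-splice {s = s} {t} desc-s junction desc-t l lo≤l 1+l≤hi with <-cmp l _
  ... | tri< l<c _ _  = subst₂ _↘_ (sym (splice-≤ s t l<c)) (sym (splice-≤ s t (<⇒≤ l<c)))
                                   (desc-s l lo≤l l<c)
  ... | tri≈ _ refl _ = subst₂ _↘_ (sym (splice-> s t ≤-refl)) (sym (splice-≤ s t ≤-refl))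
                                   (junction lo≤l 1+l≤hi)
  ... | tri> _ _ c<l  = subst₂ _↘_ (sym (splice-> s t (m<n⇒m<1+n c<l))) (sym (splice-> s t c<l))
                                   (desc-t l c<l 1+l≤hi)

  module Extremal {k} {A B : ℕ → Fin n} (isA : IsASeq π k A) (isB : IsBSeq π k B)
                  (1≤k : 1 ≤ k) where

    A-descending : Descending 1 k A
    A-descending = IsDecSeq⇒Descending (proj₁ isA)

    B-descending : Descending 1 k B
    B-descending l 1≤l 1+l≤k with proj₁ (isB k 1≤k ≤-refl)
    ... | S , S-dec , S≡B = subst₂ _↘_ (S≡B (suc l) (s≤s z≤n) 1+l≤k) (S≡B l 1≤l (<⇒≤ 1+l≤k))
                                        (S-dec l (suc l) 1≤l ≤-refl 1+l≤k)

    A-lex-least : ∀ {D T} → IsDecSeq π k T → 1 ≤ D → D ≤ k →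
                  (∀ l → D < l → l ≤ k → T l ≡ A l) → ¬ ValLt π (T D) (A D)
    A-lex-least {D} {T} T-dec 1≤D D≤k T≡A T<A with proj₂ isA T T-dec
    ... | inj₁ A≡T = ValLt⇒≢ T<A (sym (A≡T D 1≤D D≤k))
    ... | inj₂ (m , _ , m≤k , A≡T , A<T) with <-cmp m D
    ...   | tri< m<D _ _  = ValLt⇒≢ T<A (sym (A≡T D m<D D≤k))
    ...   | tri≈ _ refl _ = Finₚ.<-asym T<A A<T
    ...   | tri> _ _ D<m  = ValLt⇒≢ A<T (sym (T≡A m D<m m≤k))

    A-minimal : ∀ {D x} s → 1 ≤ D → D ≤ k → Descending 1 D s → s D ≡ x →
                (suc D ≤ k → A (suc D) ↘ x) → ¬ ValLt π x (A D)
    A-minimal {D} s 1≤D D≤k s-desc refl above =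
      A-lex-least (Descending⇒IsDecSeq T-desc) 1≤D D≤k (λ l D<l _ → splice-> s A D<l)
      ∘ subst (λ y → ValLt π y (A D)) (sym (splice-≤ s A ≤-refl))
      where
      T-desc : Descending 1 k (splice D s A)
      T-desc = Descending-splice s-desc (λ _ → above)
                                 (Descending-restrict (s≤s z≤n) ≤-refl A-descending)

    B-leftmost-at : ∀ {J W} → IsDecSeq π k W → 1 ≤ J → J ≤ k →
                    (∀ l → 1 ≤ l → l < J → W l ≡ B l) → ¬ Precedes (W J) (B J)
    B-leftmost-at W-dec 1≤J J≤k W≡B = ≤⇒≯ (proj₂ (isB _ 1≤J J≤k) _ W-dec W≡B)

    B-leftmost : ∀ {j x} t → suc j ≤ k → Descending (suc j) k t → t (suc j) ≡ x →
                 (1 ≤ j → x ↘ B j) → ¬ Precedes x (B (suc j))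
    B-leftmost {j} t 1+j≤k t-desc refl below =
      B-leftmost-at (Descending⇒IsDecSeq W-desc) (s≤s z≤n) 1+j≤k
                    (λ l _ l<1+j → splice-≤ B t (≤-pred l<1+j))
      ∘ subst (λ y → Precedes y (B (suc j))) (sym (splice-> B t ≤-refl))
      where
      W-desc : Descending 1 k (splice j B t)
      W-desc = Descending-splice (Descending-restrict ≤-refl (<⇒≤ 1+j≤k) B-descending)
                                 (λ 1≤j _ → below 1≤j) t-desc

    B-index≤A-index : ∀ {d e} → 1 ≤ d → d ≤ k → e ≤ k → A d ≡ B e → e ≤ d
    B-index≤A-index {e = zero} _ _ _ _ = z≤n
    B-index≤A-index {d} {suc e} 1≤d d≤k 1+e≤k meet with ≤-<-connex (suc e) d
    ... | inj₁ 1+e≤d = 1+e≤d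
    ... | inj₂ d<1+e with m≤n⇒∃[o]m+o≡n (≤-pred d<1+e)
    ...   | a , refl =
      contradiction (subst (ValLt π (B (d + a))) (sym meet) (proj₂ B-step))
        (A-minimal (λ l → B (l + a)) 1≤d d≤k
                   (Descending-+ a (s≤s z≤n) (≤-trans (n≤1+n _) 1+e≤k) B-descending) refl
                   (λ 1+d≤k → ↘-trans (subst (A (suc d) ↘_) meet (A-descending d 1≤d 1+d≤k))
                                      B-step))
      where
      B-step : B (suc (d + a)) ↘ B (d + a)
      B-step = B-descending (d + a) (≤-trans 1≤d (m≤m+n d a)) 1+e≤k

    A-graft-minimal : ∀ {s u} a → suc s ≤ u → u + a ≤ k → B (suc s) ↘ A (s + a) →
                      (suc (u + a) ≤ k → A (suc (u + a)) ↘ B u) → ¬ ValLt π (B u) (A (u + a))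
    -- The competitor is a_k ⋯ a_{u+a+1} b_u ⋯ b_{s+1} a_{s+a} ⋯ a_1.
    A-graft-minimal {s} {u} a s<u u+a≤k junction =
      A-minimal graft (≤-trans (s≤s z≤n) (+-monoˡ-≤ a s<u)) u+a≤k graft-desc top
      where
      graft : ℕ → Fin n
      graft = splice (s + a) A (λ p → B (p ∸ a))
      top : graft (u + a) ≡ B u
      top = trans (splice-> A _ (+-monoˡ-< a s<u)) (cong B (m+n∸n≡m u a))
      graft-desc : Descending 1 (u + a) graft
      graft-desc = Descending-splice
        (Descending-restrict ≤-refl (≤-trans (+-monoˡ-≤ a (<⇒≤ s<u)) u+a≤k) A-descending)
        (λ _ _ → subst (λ i → B i ↘ A (s + a)) (sym (m+n∸n≡m (suc s) a)) junction)
        (Descending-∸ a ≤-refl ≤-refl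
          (Descending-restrict (s≤s z≤n) (≤-trans (m≤m+n u a) u+a≤k) B-descending))

    B-graft-leftmost : ∀ {j c x} a → suc j ≤ c → c + a ≤ k → A (suc j + a) ≡ x →
                       B (suc c) ↘ A (c + a) → (1 ≤ j → x ↘ B j) → ¬ Precedes x (B (suc j))
    -- The competitor is b_k ⋯ b_{c+1} a_{c+a} ⋯ a_{j+1+a} b_j ⋯ b_1.
    B-graft-leftmost {j} {c} a j<c c+a≤k A≡x junction =
      B-leftmost graft (≤-trans j<c (≤-trans (m≤m+n c a) c+a≤k)) graft-desc
                 (trans (splice-≤ _ B j<c) A≡x)
      where
      graft : ℕ → Fin n
      graft = splice c (λ p → A (p + a)) B
      graft-desc : Descending (suc j) k graft
      graft-desc = Descending-splice (Descending-+ a (s≤s z≤n) c+a≤k A-descending)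
                                     (λ _ _ → junction)
                                     (Descending-restrict (s≤s z≤n) ≤-refl B-descending)

    label-A≡index : ∀ {i m} → 1 ≤ i → i ≤ k → IsLabel π (A i) m → m ≡ i
    label-A≡index {i} {m} 1≤i i≤k ((s , _ , s-dec , s≡A) , longest) = ≤-antisym m≤i i≤m
      where
      i≤m : i ≤ m
      i≤m = longest i A 1≤i (Descending⇒IsDecSeq (Descending-restrict ≤-refl i≤k A-descending)) refl
      m≤i : m ≤ i
      m≤i with ≤-<-connex m i
      ... | inj₁ m≤i = m≤i
      ... | inj₂ i<m = contradiction (proj₂ A↘s)
        (A-minimal s 1≤i i≤k (Descending-restrict ≤-refl (<⇒≤ i<m) (IsDecSeq⇒Descending s-dec)) refl
                   (λ 1+i≤k → ↘-trans (A-descending i 1≤i 1+i≤k) A↘s))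
        where
        A↘s : A i ↘ s i
        A↘s = subst (_↘ s i) s≡A (s-dec i m 1≤i i<m ≤-refl)

    label<index : ∀ {x i m} → 1 ≤ i → i ≤ k → (suc i ≤ k → A (suc i) ↘ x) → ValLt π x (A i) →
             IsLabel π x m → m < i
    label<index {i = i} {m} 1≤i i≤k above x<A ((s , _ , s-dec , refl) , _) with ≤-<-connex i m
    ... | inj₂ m<i = m<i
    ... | inj₁ i≤m with m≤n⇒∃[o]m+o≡n i≤m
    ...   | a , refl = contradiction x<A
      (A-minimal (λ l → s (l + a)) 1≤i i≤k
                 (Descending-+ a (s≤s z≤n) ≤-refl (IsDecSeq⇒Descending s-dec)) refl above)

    module BelowMeet {e g} (1≤e : 1 ≤ e) (d≤k : suc e + g ≤ k)
                     (meet : A (suc e + g) ≡ B (suc e)) where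

      1≤e+g : 1 ≤ e + g
      1≤e+g = ≤-trans 1≤e (m≤m+n e g)

      A-step : ∀ {i} → 1 ≤ i → i ≤ e + g → A (suc i) ↘ A i
      A-step 1≤i i≤e+g = A-descending _ 1≤i (≤-trans (s≤s i≤e+g) d≤k)

      B-step : ∀ {t} → 1 ≤ t → t ≤ e → B (suc t) ↘ B t
      B-step 1≤t t≤e = B-descending _ 1≤t (≤-trans (s≤s t≤e) (≤-trans (m≤m+n (suc e) g) d≤k))

      meet↘A : B (suc e) ↘ A (e + g)
      meet↘A = subst (_↘ A (e + g)) meet (A-step 1≤e+g ≤-refl)

      ¬B↘A-below : ∀ {t} → 1 ≤ t → t ≤ e → ¬ B t ↘ A (t + g)
      ¬B↘A-below {suc s} _ s<e B↘A =
        A-graft-minimal (suc g) s<e (subst (_≤ k) (sym (+-suc e g)) d≤k)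
          (subst (λ i → B (suc s) ↘ A i) (sym (+-suc s g)) B↘A)
          (λ 1+e+g≤k → ↘-trans (subst (A (suc (e + suc g)) ↘_) meet′
                                      (A-descending _ (≤-trans 1≤e (m≤m+n e _)) 1+e+g≤k))
                               (B-step 1≤e ≤-refl))
          (subst (ValLt π (B e)) (sym meet′) (proj₂ (B-step 1≤e ≤-refl)))
        where
        meet′ : A (e + suc g) ≡ B (suc e)
        meet′ = trans (cong A (+-suc e g)) meet

      A<B⇒A≺B-below : ∀ {t} → 1 ≤ t → t ≤ e → ValLt π (A (t + g)) (B t) → Precedes (A (t + g)) (B t)
      A<B⇒A≺B-below 1≤t t≤e A<B with ≢⇒<⊎> (ValLt⇒≢ A<B)
      ... | inj₁ A≺B = A≺B
      ... | inj₂ B≺A = contradiction (B≺A , A<B) (¬B↘A-below 1≤t t≤e)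

      ¬A≺B-below : ∀ {t} → 1 ≤ t → t ≤ e → ¬ Precedes (A (t + g)) (B t)
      ¬A≺B-below {suc t} _ t<e A≺B = B-graft-leftmost g t<e (<⇒≤ d≤k) refl meet↘A A↘B A≺B
        where
        A↘B : 1 ≤ t → A (suc t + g) ↘ B t
        A↘B 1≤t = A≺Bₜ , Bₜ<A
          where
          t≤e : t ≤ e
          t≤e = <⇒≤ t<e
          A≺Bₜ : Precedes (A (suc t + g)) (B t)
          A≺Bₜ = Finₚ.<-trans A≺B (proj₁ (B-step 1≤t t≤e))
          Bₜ<A : ValLt π (B t) (A (suc t + g))
          Bₜ<A with ≢⇒ValLt⊎ValLt (Finₚ.<⇒≢ A≺Bₜ)
          ... | inj₂ Bₜ<A = Bₜ<A
          ... | inj₁ A<Bₜ = contradiction (A<B⇒A≺B-below 1≤t t≤e (Finₚ.<-trans Aₜ<A A<Bₜ))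
                                          (¬A≺B-below 1≤t t≤e)
            where
            Aₜ<A : ValLt π (A (t + g)) (A (suc t + g))
            Aₜ<A = proj₂ (A-step (≤-trans 1≤t (m≤m+n t g)) (+-monoˡ-≤ g t≤e))

      labels-below : ValLt π (B e) (A (e + g)) →
                     ∀ m m′ → IsLabel π (B e) m → IsLabel π (A (e + g)) m′ → m < m′ × m′ ≡ e + g
      labels-below x<y m m′ ℓx ℓy = subst (m <_) (sym m′≡) m<e+g , m′≡
        where
        m′≡ : m′ ≡ e + g
        m′≡ = label-A≡index 1≤e+g (<⇒≤ d≤k) ℓy
        m<e+g : m < e + g
        m<e+g = label<index 1≤e+g (<⇒≤ d≤k) (λ _ → subst (_↘ B e) (sym meet) (B-step 1≤e ≤-refl))
                            x<y ℓx

      B↗A-below : B e ≢ A (e + g) → B e ↗ A (e + g)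
      B↗A-below x≢y with ≢⇒<⊎> x≢y
      ... | inj₂ A≺B = contradiction A≺B (¬A≺B-below 1≤e ≤-refl)
      ... | inj₁ B≺A with ≢⇒ValLt⊎ValLt x≢y
      ...   | inj₁ B<A = B≺A , B<A
      ...   | inj₂ A<B = contradiction (A<B⇒A≺B-below 1≤e ≤-refl A<B) (Finₚ.<-asym B≺A)

    module AboveMeet {j g} (i<k : suc (suc j + g) ≤ k) (meet : A (suc j + g) ≡ B (suc j)) where

      2+j≤k : suc (suc j) ≤ k
      2+j≤k = ≤-trans (s≤s (m≤m+n (suc j) g)) i<k

      A↘meet : A (suc (suc j + g)) ↘ B (suc j)
      A↘meet = subst (A (suc (suc j + g)) ↘_) meet (A-descending _ (s≤s z≤n) i<k)

      ¬B↘A-above : ∀ {l} → suc j < l → l + g ≤ k → ¬ B l ↘ A (l + g)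
      ¬B↘A-above {suc l} j<l l+g≤k B↘A =
        B-graft-leftmost (suc g) (≤-pred j<l) (subst (_≤ k) (sym (+-suc l g)) l+g≤k)
          (cong A (+-suc (suc j) g)) (subst (λ i → B (suc l) ↘ A i) (sym (+-suc l g)) B↘A)
          (λ 1≤j → ↘-trans A↘meet (B-descending j 1≤j (<⇒≤ 2+j≤k)))
          (proj₁ A↘meet)

      B↘meet : B (suc (suc j)) ↘ A (suc j + g)
      B↘meet = subst (B (suc (suc j)) ↘_) (sym meet) (B-descending (suc j) (s≤s z≤n) 2+j≤k)

      ¬B<A-above : ∀ r {l} → suc j < l → r + (l + g) ≡ k → ¬ ValLt π (B l) (A (l + g))
      ¬B<A-above zero j<l top B<A =
        A-graft-minimal g j<l (≤-reflexive top) B↘meet (λ l+g<k → contradiction top (<⇒≢ l+g<k)) B<A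
      ¬B<A-above (suc r) {l} j<l top B<A = A-graft-minimal g j<l (<⇒≤ l+g<k) B↘meet above B<A
        where
        top′ : r + (suc l + g) ≡ k
        top′ = trans (+-suc r (l + g)) top
        l+g<k : suc (l + g) ≤ k
        l+g<k = subst (suc (l + g) ≤_) top′ (m≤n+m _ r)
        A↘ : A (suc (l + g)) ↘ A (l + g)
        A↘ = A-descending _ (≤-trans (≤-trans (s≤s z≤n) j<l) (m≤m+n l g)) l+g<k
        Bₗ<A : ValLt π (B l) (A (suc (l + g)))
        Bₗ<A = Finₚ.<-trans B<A (proj₂ A↘)
        B↘ : B (suc l) ↘ B l
        B↘ = B-descending l (≤-trans (s≤s z≤n) j<l) (≤-trans (s≤s (m≤m+n l g)) l+g<k)
        B≺A : Precedes (B l) (A (suc (l + g))) → Precedes (B (suc l)) (A (suc l + g))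
        B≺A = Finₚ.<-trans (proj₁ B↘)
        ¬Bₗ≺A : ¬ Precedes (B l) (A (suc (l + g)))
        ¬Bₗ≺A Bₗ≺A with ≢⇒ValLt⊎ValLt (Finₚ.<⇒≢ (B≺A Bₗ≺A))
        ... | inj₁ B<A′ = ¬B<A-above r (≤-trans j<l (n≤1+n l)) top′ B<A′
        ... | inj₂ A<B′ = ¬B↘A-above (≤-trans j<l (n≤1+n l)) l+g<k (B≺A Bₗ≺A , A<B′)
        above : suc (l + g) ≤ k → A (suc (l + g)) ↘ B l
        above _ with ≢⇒<⊎> (ValLt⇒≢ Bₗ<A)
        ... | inj₁ Bₗ≺A = contradiction Bₗ≺A ¬Bₗ≺A
        ... | inj₂ A≺Bₗ = A≺Bₗ , Bₗ<A

      A↗B-above : A (suc (suc j + g)) ≢ B (suc (suc j)) → A (suc (suc j + g)) ↗ B (suc (suc j))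
      A↗B-above y≢z with ≢⇒ValLt⊎ValLt y≢z
      ... | inj₂ z<y = contradiction z<y (¬B<A-above (k ∸ suc (suc j + g)) ≤-refl (m∸n+n≡m i<k))
      ... | inj₁ y<z with ≢⇒<⊎> y≢z
      ...   | inj₁ y≺z = y≺z , y<z
      ...   | inj₂ z≺y = contradiction (z≺y , y<z) (¬B↘A-above ≤-refl i<k)

    meet-below : ∀ d e → 1 ≤ d → d ≤ k → 1 ≤ e → e ≤ k → A d ≡ B e → 1 < e →
      ¬ InSeq k A (B (e ∸ 1)) →
      1 < d × Precedes (B (e ∸ 1)) (A (d ∸ 1)) × ValLt π (B (e ∸ 1)) (A (d ∸ 1))
        × (∀ m m′ → IsLabel π (B (e ∸ 1)) m → IsLabel π (A (d ∸ 1)) m′ → m < m′ × m′ ≡ d ∸ 1)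
    meet-below (suc d) (suc e) _ d<k _ e<k meet (s≤s 1≤e) x∉A
      with m≤n⇒∃[o]m+o≡n (≤-pred (B-index≤A-index (s≤s z≤n) d<k e<k meet))
    ... | g , refl =
      let x≺y , x<y = B↗A-below (¬InSeq⇒≢ 1≤e+g (<⇒≤ d<k) x∉A)
      in  s≤s 1≤e+g , x≺y , x<y , labels-below x<y
      where open BelowMeet 1≤e d<k meet

    meet-above : ∀ i j → 1 ≤ i → i ≤ k → 1 ≤ j → j ≤ k → A i ≡ B j → i < k →
      ¬ InSeq k B (A (suc i)) →
      j < k × Precedes (A (suc i)) (B (suc j)) × ValLt π (A (suc i)) (B (suc j))
    meet-above i (suc j) 1≤i _ _ j≤k meet i<k y∉B
      with m≤n⇒∃[o]m+o≡n (B-index≤A-index 1≤i (<⇒≤ i<k) j≤k meet)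
    ... | g , refl = ≤-<-trans (m≤m+n (suc j) g) i<k , A↗B-above (¬InSeq⇒≢ (s≤s z≤n) 2+j≤k y∉B)
      where open AboveMeet i<k meet

lemma20 : ∀ {n} (π : Permutation′ n) (k : ℕ) → 2 ≤ k →
    (Σ (ℕ → Fin n) λ s → IsDecSeq π k s) →
    (A B : ℕ → Fin n) → IsASeq π k A → IsBSeq π k B →
    (∀ d e → 1 ≤ d → d ≤ k → 1 ≤ e → e ≤ k → A d ≡ B e → 1 < e →
       ¬ InSeq k A (B (e ∸ 1)) →
       1 < d × Precedes (B (e ∸ 1)) (A (d ∸ 1)) × ValLt π (B (e ∸ 1)) (A (d ∸ 1))
         × (∀ m m′ → IsLabel π (B (e ∸ 1)) m → IsLabel π (A (d ∸ 1)) m′ →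
              m < m′ × m′ ≡ d ∸ 1))
    × (∀ i j → 1 ≤ i → i ≤ k → 1 ≤ j → j ≤ k → A i ≡ B j → i < k →
         ¬ InSeq k B (A (suc i)) →
         j < k × Precedes (A (suc i)) (B (suc j)) × ValLt π (A (suc i)) (B (suc j)))
lemma20 π k 2≤k _ A B isA isB = meet-below , meet-above
  where open Extremal π isA isB (≤-trans (s≤s z≤n) 2≤k)
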